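{- Let $n\ge2$ be even, $z\in\tilde I^{\mathsf{FPF}}_n$ with $\hat c_{\mathsf{FPF}}(z)=(c_1,\dots,c_n)$, and suppose $i\in\mathbb Z$ is an FPF-visible descent of $z$. Then $\hat c_{\mathsf{FPF}}(s_izs_i)=(c_1,\dots,c_{i+1},c_i-1,\dots,c_n)$, i.e. it is obtained from $\hat c_{\mathsf{FPF}}(z)$ by putting $c_{i+1}$ in position $i$ and $c_i-1$ in position $i+1$ and leaving all other entries unchanged, where indices are interpreted modulo $n$.
   Context: $\tilde S_n$ is the group of bijections $\pi:\mathbb Z\to\mathbb Z$ with $\pi(i+n)=\pi(i)+n$ and $\sum_{i=1}^n\pi(i)=\sum_{i=1}^n i$; $s_i$ ($i\in\mathbb Z$) swaps $i+kn,i+1+kn$ for all $k$ and fixes other integers. $\tilde I^{\mathsf{FPF}}_n$ is the set of $z\in\tilde S_n$ with $z(z(i))=i\ne z(i)$ for all $i$. The FPF-involution code of $z$ is $\hat c_{\mathsf{FPF}}(z)=(c_1,\dots,c_n)$ where $c_i=\#\{j\in\mathbb Z: i<j,\ z(i)>z(j),\ i>z(j)\}$ (so $c_{i+n}=c_i$). An integer $i$ is an FPF-visible descent of $z$ if $\min\{i,z(i)\}>z(i+1)$. -}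

module Defs where

open import Data.Nat as ℕ using (ℕ; NonZero; _∸_)
open import Data.Integer using (ℤ; +_; _+_; _-_; _<_; _>_; _%ℕ_)
open import Data.List using (List; map; foldr; length; upTo)
open import Data.List.Membership.Propositional using (_∈_)
open import Data.List.Relation.Unary.Unique.Propositional using (Unique)
open import Data.Product using (Σ; _×_)
open import Relation.Binary.PropositionalEquality using (_≡_; _≢_)
open import Relation.Nullary using (Dec; yes; no)
open import Data.Nat using (_≟_)
open import Function.Bundles using (_⇔_)
open import Function.Definitions using (Injective; Surjective)

sum1to : ℕ → (ℤ → ℤ) → ℤ
sum1to n f = foldr _+_ (+ 0) (map (λ k → f (+ (ℕ.suc k))) (upTo n))

record IsAffinePerm (n : ℕ) (π : ℤ → ℤ) : Set where
  field
    injective  : Injective _≡_ _≡_ π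
    surjective : Surjective _≡_ _≡_ π
    periodic   : ∀ i → π (i + + n) ≡ π i + + n
    balanced   : sum1to n π ≡ sum1to n (λ i → i)

record IsFPFInvolution (n : ℕ) (z : ℤ → ℤ) : Set where
  field
    affine    : IsAffinePerm n z
    involutive : ∀ i → z (z i) ≡ i
    fpf        : ∀ i → z i ≢ i

s : (n : ℕ) .{{_ : NonZero n}} → ℤ → ℤ → ℤ
s n i j with j %ℕ n ≟ i %ℕ n
... | yes _ = j + + 1
... | no _ with j %ℕ n ≟ (i + + 1) %ℕ n
...   | yes _ = j - + 1
...   | no _ = j

InvSet : (ℤ → ℤ) → ℤ → ℤ → Set
InvSet z i j = (i < j) × (z i > z j) × (i > z j)

HasCard : (ℤ → Set) → ℕ → Set
HasCard P k = Σ (List ℤ) λ l → Unique l × length l ≡ k × (∀ j → P j ⇔ j ∈ l)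

-- c : ℤ → ℕ is the FPF-involution code of z, i.e. c i = #{ j ∈ ℤ | i < j, z i > z j, i > z j }
-- (for all i ∈ ℤ; so c (i + n) = c i and (c 1, …, c n) = ĉ_FPF(z))
IsFPFCode : (ℤ → ℤ) → (ℤ → ℕ) → Set
IsFPFCode z c = ∀ i → HasCard (InvSet z i) (c i)

FPFVisibleDescent : (ℤ → ℤ) → ℤ → Set
FPFVisibleDescent z i = (i > z (i + + 1)) × (z i > z (i + + 1))

newCode : (n : ℕ) .{{_ : NonZero n}} → (ℤ → ℕ) → ℤ → ℤ → ℕ
newCode n c i k with k %ℕ n ≟ i %ℕ n
... | yes _ = c (i + + 1)
... | no _ with k %ℕ n ≟ (i + + 1) %ℕ n
...   | yes _ = c i ∸ 1
...   | no _ = c k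

module Submission where

-- Away from the pairs (u, u + 1) with u ≡ i (mod n), which it swaps, s_i is an
-- order-preserving involution. So with a = s_i k and b = s_i j, the conditions
-- k < j, z' k > z' j, k > z' j for z' = s_i z s_i are the conditions a < b,
-- z a > z b, a > z b, except where a comparison involves a swapped pair. The
-- descent at i, transported along the period, rules out every such exception but
-- one: b = a + 1 with a ≡ i, which is an inversion of z destroyed by conjugation.
-- Thus s_i maps the k-th inversion set of z' onto the (s_i k)-th one of z, minus
-- that single element when k ≡ i + 1, and periodicity of z turns the sizes of the
-- latter into c_{i+1}, c_i and c_k.

open import Defs
open import Data.Nat as ℕ using (ℕ; NonZero; _≤_; _∸_)
import Data.Nat.Properties as ℕP
open import Data.Integer as ℤ using (ℤ; +_; -[1+_]; _+_; _-_; _*_; -_; _<_; _%ℕ_; _/ℕ_)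
import Data.Integer.Properties as ℤP
open import Data.Integer.DivMod using (a≡a%ℕn+[a/ℕn]*n; n%ℕd<d)
open import Data.Nat.DivMod using (m<n⇒m%n≡m)
open import Data.Integer.Tactic.RingSolver using (solve-∀)
open import Data.List using (List; []; _∷_; map; length; filter)
open import Data.List.Properties using (length-map; filter-all; filter-accept; filter-reject)
open import Data.List.Membership.Propositional using (_∈_)
open import Data.List.Membership.Propositional.Properties using (∈-map⁺; ∈-map⁻; ∈-filter⁺; ∈-filter⁻)
open import Data.List.Relation.Unary.Any using (here; there)
import Data.List.Relation.Unary.All as All
open import Data.List.Relation.Unary.AllPairs using (_∷_)
open import Data.List.Relation.Unary.Unique.Propositional using (Unique)
import Data.List.Relation.Unary.Unique.Propositional.Properties as Unique
open import Data.Product using (_×_; _,_; proj₁; proj₂; ∃-syntax)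
open import Data.Empty using (⊥-elim)
open import Data.Nat.Divisibility using (_∣_)
open import Relation.Nullary using (¬_; yes; no; ¬?)
open import Relation.Unary using (Decidable)
open import Relation.Binary.PropositionalEquality
open import Relation.Binary.Definitions using (tri<; tri≈; tri>)
open import Function using (_∘_)
open import Function.Bundles using (_⇔_; mk⇔; Equivalence)
open import Function.Construct.Composition using (_⇔-∘_)
open import Function.Construct.Symmetry using (⇔-sym)

HasCard-cong : {P Q : ℤ → Set} {c : ℕ} → (∀ j → P j ⇔ Q j) → HasCard P c → HasCard Q c
HasCard-cong P⇔Q (l , u , len , mem) = l , u , len , λ j → mem j ⇔-∘ ⇔-sym (P⇔Q j)

HasCard-∘ : {P : ℤ → Set} {c : ℕ} (f g : ℤ → ℤ) →
  (∀ x → f (g x) ≡ x) → (∀ y → g (f y) ≡ y) → HasCard P c → HasCard (P ∘ f) c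
HasCard-∘ {P} f g fg gf (l , u , len , mem) =
  map g l , Unique.map⁺ g-injective u , trans (length-map g l) len , λ j → mk⇔ (to j) (from j)
  where
  g-injective : ∀ {x y} → g x ≡ g y → x ≡ y
  g-injective {x} {y} e = trans (sym (fg x)) (trans (cong f e) (fg y))
  to : ∀ j → P (f j) → j ∈ map g l
  to j p = subst (_∈ map g l) (gf j) (∈-map⁺ g (Equivalence.to (mem (f j)) p))
  from : ∀ j → j ∈ map g l → P (f j)
  from j j∈ with ∈-map⁻ g j∈
  ... | x , x∈l , refl = subst P (sym (fg x)) (Equivalence.from (mem x) x∈l)

≢-dec : (a : ℤ) → Decidable (_≢ a)
≢-dec a j = ¬? (j ℤ.≟ a)

delete : ℤ → List ℤ → List ℤ
delete a = filter (≢-dec a)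

suc-length-delete : ∀ {a} {l : List ℤ} → Unique l → a ∈ l → ℕ.suc (length (delete a l)) ≡ length l
suc-length-delete {a} (a∉xs ∷ _) (here refl) =
  cong (ℕ.suc ∘ length)
    (trans (filter-reject (≢-dec a) (λ a≢a → a≢a refl)) (filter-all (≢-dec a) (All.map ≢-sym a∉xs)))
suc-length-delete {a} (x∉xs ∷ u) (there a∈xs) =
  cong ℕ.suc (trans (cong length (filter-accept (≢-dec a) (All.lookup x∉xs a∈xs))) (suc-length-delete u a∈xs))

HasCard-remove : {P : ℤ → Set} {c : ℕ} → HasCard P c → (a : ℤ) → P a →
  HasCard (λ j → P j × j ≢ a) (c ∸ 1)
HasCard-remove (l , u , len , mem) a pa =
  delete a l , Unique.filter⁺ (≢-dec a) u ,
  cong ℕ.pred (trans (suc-length-delete u (Equivalence.to (mem a) pa)) len) ,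
  λ j → mk⇔ (λ (p , j≢a) → ∈-filter⁺ (≢-dec a) (Equivalence.to (mem j) p) j≢a)
            (λ j∈ → let j∈l , j≢a = ∈-filter⁻ (≢-dec a) j∈ in Equivalence.from (mem j) j∈l , j≢a)

HasCard⇒1≤ : {P : ℤ → Set} {c : ℕ} → HasCard P c → (a : ℤ) → P a → 1 ≤ c
HasCard⇒1≤ ([] , _ , _ , mem) a pa with () ← Equivalence.to (mem a) pa
HasCard⇒1≤ (_ ∷ _ , _ , refl , _) _ _ = ℕ.s≤s ℕ.z≤n

i<i+1 : ∀ i → i < i + + 1
i<i+1 i = subst (_< i + + 1) (ℤP.+-identityʳ i) (ℤP.+-monoʳ-< i (ℤ.+<+ (ℕ.s≤s ℕ.z≤n)))

i-1<i : ∀ i → i - + 1 < i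
i-1<i i = subst (i - + 1 <_) (ℤP.+-identityʳ i) (ℤP.+-monoʳ-< i ℤ.-<+)

i<j⇒i+1≤j : ∀ {i j} → i < j → i + + 1 ℤ.≤ j
i<j⇒i+1≤j {i} {j} i<j = subst (ℤ._≤ j) (ℤP.+-comm (+ 1) i) (ℤP.i<j⇒suc[i]≤j i<j)

i<j⇒i≤j-1 : ∀ {i j} → i < j → i ℤ.≤ j - + 1
i<j⇒i≤j-1 {i} {j} i<j = subst (i ℤ.≤_) (ℤP.+-comm (- + 1) j) (ℤP.i<j⇒i≤pred[j] i<j)

module Residues (n : ℕ) .{{_ : NonZero n}} where

  infix 4 _≡ₙ_
  record _≡ₙ_ (x y : ℤ) : Set where
    constructor congruent
    field remainders : x %ℕ n ≡ y %ℕ n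

  ≡ₙ-sym : ∀ {x y} → x ≡ₙ y → y ≡ₙ x
  ≡ₙ-sym (congruent e) = congruent (sym e)

  ≡ₙ-trans : ∀ {x y z} → x ≡ₙ y → y ≡ₙ z → x ≡ₙ z
  ≡ₙ-trans (congruent e) (congruent e') = congruent (trans e e')

  private
    +r≡+r'+kn⇒n≤r : ∀ k r r' → .{{NonZero k}} → + r ≡ + r' + + k * + n → n ≤ r
    +r≡+r'+kn⇒n≤r k r r' e =
      subst (n ≤_) (sym r≡r'+kn) (ℕP.≤-trans (ℕP.m≤n*m n k) (ℕP.m≤n+m (k ℕ.* n) r'))
      where
      r≡r'+kn : r ≡ r' ℕ.+ k ℕ.* n
      r≡r'+kn = ℤP.+-injective
        (trans e (trans (cong (_+_ (+ r')) (sym (ℤP.pos-* k n))) (sym (ℤP.pos-+ r' (k ℕ.* n)))))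

  remainder-unique : ∀ {r r'} k → r ℕ.< n → r' ℕ.< n → + r ≡ + r' + k * + n → r ≡ r'
  remainder-unique {r} {r'} (+ 0) _ _ e =
    ℤP.+-injective (trans e (trans (cong (_+_ (+ r')) (ℤP.*-zeroˡ (+ n))) (ℤP.+-identityʳ (+ r'))))
  remainder-unique {r} {r'} (+ ℕ.suc k) r<n _ e = ⊥-elim (ℕP.<⇒≱ r<n (+r≡+r'+kn⇒n≤r (ℕ.suc k) r r' e))
  remainder-unique {r} {r'} -[1+ k ] _ r'<n e = ⊥-elim (ℕP.<⇒≱ r'<n (+r≡+r'+kn⇒n≤r (ℕ.suc k) r' r e'))
    where
    regroup : ∀ b m N → b ≡ (b + - m * N) + m * N
    regroup = solve-∀
    e' : + r' ≡ + r + + ℕ.suc k * + n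
    e' = trans (regroup (+ r') (+ ℕ.suc k) (+ n)) (cong (_+ + ℕ.suc k * + n) (sym e))

  +multiple-≡ₙ : ∀ y m → y + m * + n ≡ₙ y
  +multiple-≡ₙ y m = congruent (remainder-unique (q + m - q′) (n%ℕd<d y′ n) (n%ℕd<d y n) (begin
    + r′                                  ≡⟨ shift (+ r′) q′ (+ n) ⟩
    (+ r′ + q′ * + n) - q′ * + n          ≡⟨ cong (_- q′ * + n) (sym (a≡a%ℕn+[a/ℕn]*n y′ n)) ⟩
    y′ - q′ * + n                         ≡⟨ cong (λ t → t + m * + n - q′ * + n) (a≡a%ℕn+[a/ℕn]*n y n) ⟩
    (+ r + q * + n + m * + n) - q′ * + n  ≡⟨ regroup (+ r) q m q′ (+ n) ⟩
    + r + (q + m - q′) * + n              ∎))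
    where
    open ≡-Reasoning
    y′ = y + m * + n
    r = y %ℕ n
    q = y /ℕ n
    r′ = y′ %ℕ n
    q′ = y′ /ℕ n
    shift : ∀ r q N → r ≡ (r + q * N) - q * N
    shift = solve-∀
    regroup : ∀ r q m q′ N → (r + q * N + m * N) - q′ * N ≡ r + (q + m - q′) * N
    regroup = solve-∀

  ≡ₙ⇒multiple : ∀ {x y} → x ≡ₙ y → ∃[ m ] x ≡ y + m * + n
  ≡ₙ⇒multiple {x} {y} (congruent x≡ₙy) = x /ℕ n - y /ℕ n , (begin
    x                                              ≡⟨ a≡a%ℕn+[a/ℕn]*n x n ⟩
    + (x %ℕ n) + x /ℕ n * + n                      ≡⟨ cong (λ r → + r + x /ℕ n * + n) x≡ₙy ⟩
    + (y %ℕ n) + x /ℕ n * + n                      ≡⟨ regroup (+ (y %ℕ n)) (x /ℕ n) (y /ℕ n) (+ n) ⟩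
    (+ (y %ℕ n) + y /ℕ n * + n) + (x /ℕ n - y /ℕ n) * + n
                                                   ≡⟨ cong (_+ (x /ℕ n - y /ℕ n) * + n) (sym (a≡a%ℕn+[a/ℕn]*n y n)) ⟩
    y + (x /ℕ n - y /ℕ n) * + n                    ∎)
    where
    open ≡-Reasoning
    regroup : ∀ r q q' N → r + q * N ≡ (r + q' * N) + (q - q') * N
    regroup = solve-∀

  ≡ₙ-+ : ∀ {x y} d → x ≡ₙ y → x + d ≡ₙ y + d
  ≡ₙ-+ {x} {y} d x≡ₙy with m , refl ← ≡ₙ⇒multiple x≡ₙy =
    subst (_≡ₙ y + d) (sym (regroup y m (+ n) d)) (+multiple-≡ₙ (y + d) m)
    where
    regroup : ∀ y m N d → y + m * N + d ≡ y + d + m * N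
    regroup = solve-∀

  0≢ₙ1 : 2 ≤ n → ¬ (+ 0 ≡ₙ + 1)
  0≢ₙ1 n≥2 (congruent 0%n≡1%n) =
    ℕP.0≢1+n (trans (sym (m<n⇒m%n≡m (ℕP.<-trans (ℕP.n<1+n 0) n≥2)))
                    (trans 0%n≡1%n (m<n⇒m%n≡m n≥2)))

  x≢ₙx+1 : 2 ≤ n → ∀ x → ¬ (x ≡ₙ x + + 1)
  x≢ₙx+1 n≥2 x = 0≢ₙ1 n≥2 ∘ subst₂ _≡ₙ_ (x-x x) (x+1-x x) ∘ ≡ₙ-+ (- x)
    where
    x-x : ∀ x → x - x ≡ + 0
    x-x = solve-∀
    x+1-x : ∀ x → x + + 1 - x ≡ + 1
    x+1-x = solve-∀

module Periodic (n : ℕ) .{{_ : NonZero n}} (f : ℤ → ℤ) (periodic : ∀ x → f (x + + n) ≡ f x + + n) where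
  open Residues n

  periodic-ℕ* : ∀ k x → f (x + + k * + n) ≡ f x + + k * + n
  periodic-ℕ* 0 x = trans (cong f (ℤP.+-identityʳ x)) (sym (ℤP.+-identityʳ (f x)))
  periodic-ℕ* (ℕ.suc k) x = begin
    f (x + + ℕ.suc k * + n)     ≡⟨ cong f (regroup x (+ k) (+ n)) ⟩
    f ((x + + k * + n) + + n)   ≡⟨ periodic _ ⟩
    f (x + + k * + n) + + n     ≡⟨ cong (_+ + n) (periodic-ℕ* k x) ⟩
    (f x + + k * + n) + + n     ≡⟨ sym (regroup (f x) (+ k) (+ n)) ⟩
    f x + + ℕ.suc k * + n       ∎
    where
    open ≡-Reasoning
    regroup : ∀ x k N → x + (+ 1 + k) * N ≡ (x + k * N) + N
    regroup = solve-∀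

  periodic-* : ∀ m x → f (x + m * + n) ≡ f x + m * + n
  periodic-* (+ k) x = periodic-ℕ* k x
  periodic-* -[1+ k ] x = begin
    f t                                  ≡⟨ regroup (f t) (+ ℕ.suc k) (+ n) ⟩
    (f t + + ℕ.suc k * + n) + m * + n    ≡⟨ cong (_+ m * + n) (sym (periodic-ℕ* (ℕ.suc k) t)) ⟩
    f (t + + ℕ.suc k * + n) + m * + n    ≡⟨ cong (λ u → f u + m * + n) (cancel x (+ ℕ.suc k) (+ n)) ⟩
    f x + m * + n                        ∎
    where
    open ≡-Reasoning
    m = -[1+ k ]
    t = x + m * + n
    regroup : ∀ a k N → a ≡ (a + k * N) + - k * N
    regroup = solve-∀
    cancel : ∀ x k N → (x + - k * N) + k * N ≡ x
    cancel = solve-∀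

  periodic-≡ₙ : ∀ {x y} → x ≡ₙ y → f x ≡ f y + (x - y)
  periodic-≡ₙ {x} {y} x≡ₙy with m , refl ← ≡ₙ⇒multiple x≡ₙy =
    trans (periodic-* m y) (cong (_+_ (f y)) (difference y (m * + n)))
    where
    difference : ∀ y d → d ≡ (y + d) - y
    difference = solve-∀

  InvSet-translate : ∀ m {x y} → InvSet f x y → InvSet f (x + m * + n) (y + m * + n)
  InvSet-translate m {x} {y} (x<y , fy<fx , fy<x) =
    ℤP.+-monoˡ-< d x<y ,
    subst₂ _<_ (sym (periodic-* m y)) (sym (periodic-* m x)) (ℤP.+-monoˡ-< d fy<fx) ,
    subst (_< x + d) (sym (periodic-* m y)) (ℤP.+-monoˡ-< d fy<x)
    where d = m * + n

  HasCard-translate : ∀ {x k} m → HasCard (InvSet f x) k → HasCard (InvSet f (x + m * + n)) k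
  HasCard-translate {x} m card = HasCard-cong translated (HasCard-∘ (_- d) (_+ d) (+d-d d) (-d+d d) card)
    where
    d = m * + n
    +d-d : ∀ d j → j + d - d ≡ j
    +d-d = solve-∀
    -d+d : ∀ d j → j - d + d ≡ j
    -d+d = solve-∀
    +[-m]n : ∀ j m N → j + - m * N ≡ j - m * N
    +[-m]n = solve-∀
    +mn-mn : ∀ x m N → x + m * N + - m * N ≡ x
    +mn-mn = solve-∀
    translated : ∀ j → InvSet f x (j - d) ⇔ InvSet f (x + d) j
    translated j = mk⇔
      (λ v → subst (InvSet f (x + d)) (-d+d d j) (InvSet-translate m v))
      (λ v → subst₂ (InvSet f) (+mn-mn x m (+ n)) (+[-m]n j m (+ n)) (InvSet-translate (- m) v))

  code-≡ₙ : ∀ {c} → IsFPFCode f c → ∀ {x y} → x ≡ₙ y → HasCard (InvSet f x) (c y)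
  code-≡ₙ code {x} {y} x≡ₙy with m , refl ← ≡ₙ⇒multiple x≡ₙy = HasCard-translate m (code y)

module Transposition (n : ℕ) .{{_ : NonZero n}} (n≥2 : 2 ≤ n) (i : ℤ) where
  open Residues n

  sᵢ : ℤ → ℤ
  sᵢ = s n i

  Low High : ℤ → Set
  Low x = x ≡ₙ i
  High x = x ≡ₙ i + + 1

  SwapPair : ℤ → ℤ → Set
  SwapPair x y = Low x × y ≡ x + + 1

  private
    +1-1 : ∀ x → x + + 1 - + 1 ≡ x
    +1-1 = solve-∀
    -1+1 : ∀ x → x - + 1 + + 1 ≡ x
    -1+1 = solve-∀

  Low⇒¬High : ∀ {x} → Low x → ¬ High x
  Low⇒¬High lo hi = x≢ₙx+1 n≥2 i (≡ₙ-trans (≡ₙ-sym lo) hi)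

  Low⇒High-+1 : ∀ {x} → Low x → High (x + + 1)
  Low⇒High-+1 = ≡ₙ-+ (+ 1)

  High⇒Low--1 : ∀ {x} → High x → Low (x - + 1)
  High⇒Low--1 hi = subst (_ ≡ₙ_) (+1-1 i) (≡ₙ-+ (- + 1) hi)

  data Position (x : ℤ) : Set where
    low   : Low x → Position x
    high  : High x → Position x
    other : ¬ Low x → ¬ High x → Position x

  position : ∀ x → Position x
  position x with x %ℕ n ℕ.≟ i %ℕ n
  ... | yes lo = low (congruent lo)
  ... | no ¬lo with x %ℕ n ℕ.≟ (i + + 1) %ℕ n
  ...   | yes hi = high (congruent hi)
  ...   | no ¬hi = other (¬lo ∘ _≡ₙ_.remainders) (¬hi ∘ _≡ₙ_.remainders)

  sᵢ-low : ∀ {x} → Low x → sᵢ x ≡ x + + 1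
  sᵢ-low {x} lo with x %ℕ n ℕ.≟ i %ℕ n
  ... | yes _ = refl
  ... | no ¬lo = ⊥-elim (¬lo (_≡ₙ_.remainders lo))

  sᵢ-high : ∀ {x} → High x → sᵢ x ≡ x - + 1
  sᵢ-high {x} hi with x %ℕ n ℕ.≟ i %ℕ n
  ... | yes lo = ⊥-elim (Low⇒¬High (congruent lo) hi)
  ... | no _ with x %ℕ n ℕ.≟ (i + + 1) %ℕ n
  ...   | yes _ = refl
  ...   | no ¬hi = ⊥-elim (¬hi (_≡ₙ_.remainders hi))

  sᵢ-other : ∀ {x} → ¬ Low x → ¬ High x → sᵢ x ≡ x
  sᵢ-other {x} ¬lo ¬hi with x %ℕ n ℕ.≟ i %ℕ n
  ... | yes lo = ⊥-elim (¬lo (congruent lo))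
  ... | no _ with x %ℕ n ℕ.≟ (i + + 1) %ℕ n
  ...   | yes hi = ⊥-elim (¬hi (congruent hi))
  ...   | no _ = refl

  newCode-low : ∀ (c : ℤ → ℕ) {k} → Low k → newCode n c i k ≡ c (i + + 1)
  newCode-low c {k} lo with k %ℕ n ℕ.≟ i %ℕ n
  ... | yes _ = refl
  ... | no ¬lo = ⊥-elim (¬lo (_≡ₙ_.remainders lo))

  newCode-high : ∀ (c : ℤ → ℕ) {k} → High k → newCode n c i k ≡ c i ∸ 1
  newCode-high c {k} hi with k %ℕ n ℕ.≟ i %ℕ n
  ... | yes lo = ⊥-elim (Low⇒¬High (congruent lo) hi)
  ... | no _ with k %ℕ n ℕ.≟ (i + + 1) %ℕ n
  ...   | yes _ = refl
  ...   | no ¬hi = ⊥-elim (¬hi (_≡ₙ_.remainders hi))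

  newCode-other : ∀ (c : ℤ → ℕ) {k} → ¬ Low k → ¬ High k → newCode n c i k ≡ c k
  newCode-other c {k} ¬lo ¬hi with k %ℕ n ℕ.≟ i %ℕ n
  ... | yes lo = ⊥-elim (¬lo (congruent lo))
  ... | no _ with k %ℕ n ℕ.≟ (i + + 1) %ℕ n
  ...   | yes hi = ⊥-elim (¬hi (congruent hi))
  ...   | no _ = refl

  sᵢ-+1 : ∀ {x} → Low x → sᵢ (x + + 1) ≡ x
  sᵢ-+1 {x} lo = trans (sᵢ-high (Low⇒High-+1 lo)) (+1-1 x)

  sᵢ-involutive : ∀ x → sᵢ (sᵢ x) ≡ x
  sᵢ-involutive x with position x
  ... | low lo = trans (cong sᵢ (sᵢ-low lo)) (sᵢ-+1 lo)
  ... | high hi = trans (cong sᵢ (sᵢ-high hi)) (trans (sᵢ-low (High⇒Low--1 hi)) (-1+1 x))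
  ... | other ¬lo ¬hi = trans (cong sᵢ (sᵢ-other ¬lo ¬hi)) (sᵢ-other ¬lo ¬hi)

  sᵢ-swap : ∀ {x y} → SwapPair x y → sᵢ x ≡ y × sᵢ y ≡ x
  sᵢ-swap (lo , refl) = sᵢ-low lo , sᵢ-+1 lo

  sᵢ-<-bound : ∀ {x b} → x < b → ¬ High b → sᵢ x < b
  sᵢ-<-bound {x} {b} x<b ¬high-b with position x
  ... | low lo = subst (_< b) (sym (sᵢ-low lo))
      (ℤP.≤∧≢⇒< (i<j⇒i+1≤j x<b) (λ x+1≡b → ¬high-b (subst High x+1≡b (Low⇒High-+1 lo))))
  ... | high hi = subst (_< b) (sym (sᵢ-high hi)) (ℤP.<-trans (i-1<i x) x<b)
  ... | other ¬lo ¬hi = subst (_< b) (sym (sᵢ-other ¬lo ¬hi)) x<b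

  ≤-sᵢ : ∀ {y} → ¬ High y → y ℤ.≤ sᵢ y
  ≤-sᵢ {y} ¬hi with position y
  ... | low lo = subst (y ℤ.≤_) (sym (sᵢ-low lo)) (ℤP.<⇒≤ (i<i+1 y))
  ... | high hi = ⊥-elim (¬hi hi)
  ... | other ¬lo _ = ℤP.≤-reflexive (sym (sᵢ-other ¬lo ¬hi))

  sᵢ-mono-< : ∀ {x y} → x < y → ¬ SwapPair x y → sᵢ x < sᵢ y
  sᵢ-mono-< {x} {y} x<y ¬swap with position y
  ... | high hi = subst (sᵢ x <_) (sym (sᵢ-high hi)) (sᵢ-<-bound x<y-1 (Low⇒¬High (High⇒Low--1 hi)))
    where
    x<y-1 : x < y - + 1
    x<y-1 = ℤP.≤∧≢⇒< (i<j⇒i≤j-1 x<y)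
      (λ { refl → ¬swap (High⇒Low--1 hi , sym (-1+1 y)) })
  ... | low lo = ℤP.<-≤-trans (sᵢ-<-bound x<y (Low⇒¬High lo)) (≤-sᵢ (Low⇒¬High lo))
  ... | other _ ¬hi = ℤP.<-≤-trans (sᵢ-<-bound x<y ¬hi) (≤-sᵢ ¬hi)

  sᵢ-cancel-< : ∀ {x y} → sᵢ x < sᵢ y → ¬ SwapPair y x → x < y
  sᵢ-cancel-< {x} {y} sx<sy ¬swap with ℤP.<-cmp x y
  ... | tri< x<y _ _ = x<y
  ... | tri≈ _ refl _ = ⊥-elim (ℤP.<-irrefl refl sx<sy)
  ... | tri> _ _ y<x = ⊥-elim (ℤP.<-asym sx<sy (sᵢ-mono-< y<x ¬swap))

module Conjugation (n : ℕ) .{{_ : NonZero n}} (n≥2 : 2 ≤ n) (i : ℤ) (z : ℤ → ℤ)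
  (involutive : ∀ x → z (z x) ≡ x) (periodic : ∀ x → z (x + + n) ≡ z x + + n)
  (descent : FPFVisibleDescent z i) where
  open Residues n
  open Periodic n z periodic
  open Transposition n n≥2 i

  descent-at : ∀ {u} → Low u → z (u + + 1) < u × z (u + + 1) < z u
  descent-at {u} lo =
    subst₂ _<_ (sym z[u+1]) (i+[u-i] i u) (ℤP.+-monoˡ-< (u - i) (proj₁ descent)) ,
    subst₂ _<_ (sym z[u+1]) (sym (periodic-≡ₙ lo)) (ℤP.+-monoˡ-< (u - i) (proj₂ descent))
    where
    i+[u-i] : ∀ i u → i + (u - i) ≡ u
    i+[u-i] = solve-∀
    [u+1]-[i+1] : ∀ i u → (u + + 1) - (i + + 1) ≡ u - i
    [u+1]-[i+1] = solve-∀
    z[u+1] : z (u + + 1) ≡ z (i + + 1) + (u - i)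
    z[u+1] = trans (periodic-≡ₙ (≡ₙ-+ (+ 1) lo)) (cong (_+_ (z (i + + 1))) ([u+1]-[i+1] i u))

  descent-inversion : ∀ {u} → Low u → InvSet z u (u + + 1)
  descent-inversion {u} lo = i<i+1 u , proj₂ (descent-at lo) , proj₁ (descent-at lo)

  SwapPair-image : ∀ {x y} → SwapPair (z x) (z y) → y < z x × y < x
  SwapPair-image {x} {y} (lo , zy≡zx+1) =
    subst (_< z x) z[zx+1]≡y (proj₁ (descent-at lo)) ,
    subst₂ _<_ z[zx+1]≡y (involutive x) (proj₂ (descent-at lo))
    where
    z[zx+1]≡y : z (z x + + 1) ≡ y
    z[zx+1]≡y = trans (cong z (sym zy≡zx+1)) (involutive y)

  W : ℤ → ℤ
  W = sᵢ ∘ z ∘ sᵢ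

  W∘sᵢ : ∀ a → W (sᵢ a) ≡ sᵢ (z a)
  W∘sᵢ a = cong (sᵢ ∘ z) (sᵢ-involutive a)

  InvSet-conjugate : ∀ a b → InvSet W (sᵢ a) (sᵢ b) ⇔ (InvSet z a b × ¬ SwapPair a b)
  InvSet-conjugate a b = mk⇔ to from
    where
    to : InvSet W (sᵢ a) (sᵢ b) → InvSet z a b × ¬ SwapPair a b
    to (sa<sb , Wb<Wa , Wb<sa) = (a<b , zb<za , zb<a) , ¬swap-ab
      where
      s[zb]<s[za] : sᵢ (z b) < sᵢ (z a)
      s[zb]<s[za] = subst₂ _<_ (W∘sᵢ b) (W∘sᵢ a) Wb<Wa
      s[zb]<sa : sᵢ (z b) < sᵢ a
      s[zb]<sa = subst (_< sᵢ a) (W∘sᵢ b) Wb<sa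
      ¬swap-ba : ¬ SwapPair b a
      ¬swap-ba (lo , refl) =
        ℤP.<-asym za<zb (sᵢ-cancel-< s[zb]<s[za] λ swap → ℤP.<-asym za<b (proj₁ (SwapPair-image swap)))
        where
        za<b = proj₁ (descent-at lo)
        za<zb = proj₂ (descent-at lo)
      a<b : a < b
      a<b = sᵢ-cancel-< sa<sb ¬swap-ba
      ¬swap-ab : ¬ SwapPair a b
      ¬swap-ab swap = ℤP.<-asym a<b (subst₂ _<_ (proj₁ (sᵢ-swap swap)) (proj₂ (sᵢ-swap swap)) sa<sb)
      zb<za : z b < z a
      zb<za = sᵢ-cancel-< s[zb]<s[za] λ swap → ℤP.<-asym a<b (proj₂ (SwapPair-image swap))
      zb<a : z b < a
      zb<a = sᵢ-cancel-< s[zb]<sa λ { (lo , zb≡a+1) →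
        ℤP.<-asym a<b (subst (_< a) (trans (cong z (sym zb≡a+1)) (involutive b)) (proj₁ (descent-at lo))) }
    from : InvSet z a b × ¬ SwapPair a b → InvSet W (sᵢ a) (sᵢ b)
    from ((a<b , zb<za , zb<a) , ¬swap-ab) =
      sᵢ-mono-< a<b ¬swap-ab ,
      subst₂ _<_ (sym (W∘sᵢ b)) (sym (W∘sᵢ a))
        (sᵢ-mono-< zb<za λ swap → ℤP.<-asym zb<a (proj₁ (SwapPair-image swap))) ,
      subst (_< sᵢ a) (sym (W∘sᵢ b))
        (sᵢ-mono-< zb<a λ { (lo , refl) → ℤP.<-asym zb<za (proj₁ (descent-at lo)) })

  HasCard-conjugate : ∀ k {m} → HasCard (λ b → InvSet z (sᵢ k) b × ¬ SwapPair (sᵢ k) b) m →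
    HasCard (InvSet W k) m
  HasCard-conjugate k card = HasCard-cong conjugated (HasCard-∘ sᵢ sᵢ sᵢ-involutive sᵢ-involutive card)
    where
    conjugated : ∀ j → (InvSet z (sᵢ k) (sᵢ j) × ¬ SwapPair (sᵢ k) (sᵢ j)) ⇔ InvSet W k j
    conjugated j =
      subst₂ (λ k′ j′ → (InvSet z (sᵢ k) (sᵢ j) × ¬ SwapPair (sᵢ k) (sᵢ j)) ⇔ InvSet W k′ j′)
        (sᵢ-involutive k) (sᵢ-involutive j) (⇔-sym (InvSet-conjugate (sᵢ k) (sᵢ j)))

  HasCard-unswapped : ∀ {a m} → ¬ Low a → HasCard (InvSet z a) m →
    HasCard (λ b → InvSet z a b × ¬ SwapPair a b) m
  HasCard-unswapped ¬lo = HasCard-cong λ b → mk⇔ (λ v → v , ¬lo ∘ proj₁) proj₁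

  HasCard-unswapped-low : ∀ {a m} → Low a → HasCard (InvSet z a) m →
    HasCard (λ b → InvSet z a b × ¬ SwapPair a b) (m ∸ 1)
  HasCard-unswapped-low {a} lo card =
    HasCard-cong (λ b → mk⇔ (λ (v , b≢a+1) → v , b≢a+1 ∘ proj₂)
                            (λ (v , ¬swap) → v , λ e → ¬swap (lo , e)))
      (HasCard-remove card (a + + 1) (descent-inversion lo))

  conjugate-code : ∀ {c} → IsFPFCode z c → IsFPFCode W (newCode n c i)
  conjugate-code {c} code k with position k
  ... | low lo = subst (HasCard (InvSet W k)) (sym (newCode-low c lo))
    (HasCard-conjugate k (HasCard-unswapped (λ lo′ → Low⇒¬High lo′ hi) (code-≡ₙ code hi)))
    where
    hi : High (sᵢ k)
    hi = subst High (sym (sᵢ-low lo)) (Low⇒High-+1 lo)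
  ... | high hi = subst (HasCard (InvSet W k)) (sym (newCode-high c hi))
    (HasCard-conjugate k (HasCard-unswapped-low lo (code-≡ₙ code lo)))
    where
    lo : Low (sᵢ k)
    lo = subst Low (sym (sᵢ-high hi)) (High⇒Low--1 hi)
  ... | other ¬lo ¬hi = subst (HasCard (InvSet W k)) (sym (newCode-other c ¬lo ¬hi))
    (HasCard-conjugate k (HasCard-unswapped (¬lo ∘ subst Low sk≡k)
      (subst (λ a → HasCard (InvSet z a) (c k)) (sym sk≡k) (code k))))
    where
    sk≡k : sᵢ k ≡ k
    sk≡k = sᵢ-other ¬lo ¬hi

proposition3p23 : (n : ℕ) → .{{_ : NonZero n}} → 2 ≤ n → 2 ∣ n →
    (z : ℤ → ℤ) → IsFPFInvolution n z →
    (c : ℤ → ℕ) → IsFPFCode z c →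
    (i : ℤ) → FPFVisibleDescent z i →
    (1 ≤ c i) × IsFPFCode (s n i ∘ z ∘ s n i) (newCode n c i)
proposition3p23 n n≥2 _ z z-fpf c code i descent =
  HasCard⇒1≤ (code i) (i + + 1) (descent-inversion (congruent refl)) , conjugate-code code
  where
  open IsFPFInvolution z-fpf using (involutive; affine)
  open Conjugation n n≥2 i z involutive (IsAffinePerm.periodic affine) descent
  open Residues n using (congruent)
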